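{- Let $M$ be a first-order structure, $A\subseteq M$, $v$ a finite tuple in $M$, and let $\mathcal{H}_1,\mathcal{H}_2\subseteq\mathrm{Aut}_A(M)$ be such that for $i\in\{1,2\}$ the set $\mathcal{H}_i\cdot v=\{h(v)\mid h\in\mathcal{H}_i\}$ is definable over $v$. Then $(\mathcal{H}_1\circ\mathcal{H}_2)\cdot v$ is definable over $v$, where $\mathcal{H}_1\circ\mathcal{H}_2=\{h_1\circ h_2\mid h_1\in\mathcal{H}_1,h_2\in\mathcal{H}_2\}$.
   Context: $\mathrm{Aut}_A(M)$ denotes the group of automorphisms of $M$ fixing $A$ pointwise. -}

module Defs where

open import Data.Nat using (ℕ; zero; suc; _+_)
open import Data.Fin using (Fin)
open import Data.Vec using (Vec; []; _∷_; lookup; map; _++_)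
open import Data.Product using (Σ; _×_; _,_)
open import Data.Sum using (_⊎_)
open import Data.Empty using (⊥)
open import Relation.Binary.PropositionalEquality using (_≡_)
open import Function.Bundles using (_⇔_)
open import Level using (Level; _⊔_) renaming (suc to lsuc; zero to lzero)

-- First-order signatures: function and relation symbols with arities
-- (constants are 0-ary function symbols).
record Signature : Set₁ where
  field
    Fun      : Set
    funArity : Fun → ℕ
    Rel      : Set
    relArity : Rel → ℕ

module _ (L : Signature) where
  open Signature L

  record Structure : Set₁ where
    field
      Carrier : Set
      funI    : (f : Fun) → Vec Carrier (funArity f) → Carrier
      relI    : (r : Rel) → Vec Carrier (relArity r) → Set

  -- Terms and first-order formulas with free variables among Fin k
  -- (de Bruijn: a quantifier binds variable zero).
  data Term (k : ℕ) : Set where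
    var : Fin k → Term k
    app : (f : Fun) → Vec (Term k) (funArity f) → Term k

  data Formula (k : ℕ) : Set where
    falsum : Formula k
    equal  : Term k → Term k → Formula k
    rel    : (r : Rel) → Vec (Term k) (relArity r) → Formula k
    and    : Formula k → Formula k → Formula k
    or     : Formula k → Formula k → Formula k
    imp    : Formula k → Formula k → Formula k
    all    : Formula (suc k) → Formula k
    ex     : Formula (suc k) → Formula k

module _ {L : Signature} (M : Structure L) where
  open Signature L
  open Structure M

  mutual
    evalTerm : ∀ {k} → Term L k → Vec Carrier k → Carrier
    evalTerm (var i) ρ = lookup ρ i
    evalTerm (app f ts) ρ = funI f (evalTerms ts ρ)

    evalTerms : ∀ {k n} → Vec (Term L k) n → Vec Carrier k → Vec Carrier n
    evalTerms [] ρ = []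
    evalTerms (t ∷ ts) ρ = evalTerm t ρ ∷ evalTerms ts ρ

  Sat : ∀ {k} → Formula L k → Vec Carrier k → Set
  Sat falsum ρ = ⊥
  Sat (equal s t) ρ = evalTerm s ρ ≡ evalTerm t ρ
  Sat (rel r ts) ρ = relI r (evalTerms ts ρ)
  Sat (and φ ψ) ρ = Sat φ ρ × Sat ψ ρ
  Sat (or φ ψ) ρ = Sat φ ρ ⊎ Sat ψ ρ
  Sat (imp φ ψ) ρ = Sat φ ρ → Sat ψ ρ
  Sat (all φ) ρ = (a : Carrier) → Sat φ (a ∷ ρ)
  Sat (ex φ) ρ = Σ Carrier (λ a → Sat φ (a ∷ ρ))

  record Aut : Set₁ where
    field
      fun   : Carrier → Carrier
      inv   : Carrier → Carrier
      inv-l : ∀ x → inv (fun x) ≡ x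
      inv-r : ∀ x → fun (inv x) ≡ x
      pres-fun : ∀ (f : Fun) (xs : Vec Carrier (funArity f)) →
                 fun (funI f xs) ≡ funI f (map fun xs)
      pres-rel : ∀ (r : Rel) (xs : Vec Carrier (relArity r)) →
                 relI r xs ⇔ relI r (map fun xs)
  open Aut public

  FixesPointwise : (Carrier → Set) → Aut → Set
  FixesPointwise A h = ∀ a → A a → fun h a ≡ a

  SubsetAut : (Carrier → Set) → (Aut → Set) → Set₁
  SubsetAut A H = ∀ h → H h → FixesPointwise A h

  -- H₁ ∘ H₂ = { h₁ ∘ h₂ | h₁ ∈ H₁, h₂ ∈ H₂ }  (equality of automorphisms as
  -- equality of underlying maps, pointwise).
  _∘ᴴ_ : (Aut → Set) → (Aut → Set) → Aut → Set₁
  (H₁ ∘ᴴ H₂) h = Σ Aut (λ h₁ → Σ Aut (λ h₂ →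
                   H₁ h₁ × H₂ h₂ × (∀ x → fun h x ≡ fun h₁ (fun h₂ x))))

  orbit : ∀ {ℓ} {n} → (Aut → Set ℓ) → Vec Carrier n → Vec Carrier n → Set (lsuc lzero ⊔ ℓ)
  orbit H v x = Σ Aut (λ h → H h × map (fun h) v ≡ x)

  -- A set D ⊆ Mⁿ is definable over the m-tuple v: there is a formula
  -- φ(x̄, ȳ) with |x̄| = n, |ȳ| = m such that D = φ(M, v).
  DefinableOver : ∀ {ℓ} {n m} → Vec Carrier m → (Vec Carrier n → Set ℓ) → Set ℓ
  DefinableOver {n = n} {m = m} v D =
    Σ (Formula L (n + m)) (λ φ → ∀ x → D x ⇔ Sat φ (x ++ v))

module Submission where

-- Write Oᵢ = Hᵢ·v and let φᵢ(x̄, ȳ) define Oᵢ over v.  An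
-- automorphism h₁ maps O₂ = φ₂(M, v) onto φ₂(M, h₁(v)), hence
--   x ∈ (H₁ ∘ H₂)·v  ⇔  ∃ h₁ ∈ H₁. x ∈ h₁(O₂)
--                    ⇔  ∃ w ∈ O₁. M ⊨ φ₂(x, w)
--                    ⇔  M ⊨ ∃w̄ (φ₁(w̄, v) ∧ φ₂(x, w̄)),
-- so this last formula defines (H₁ ∘ H₂)·v over v.

open import Defs
open import Level using (Level)
open import Data.Nat using (ℕ; zero; suc; _+_)
open import Data.Fin using (Fin; zero; suc; splitAt; _↑ˡ_; _↑ʳ_)
open import Data.Vec using (Vec; []; _∷_; lookup; map; _++_)
open import Data.Vec.Properties
  using (lookup-splitAt; lookup-++ˡ; lookup-++ʳ; map-++; map-∘; map-cong; lookup-map)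
open import Data.Product using (Σ; _×_; _,_)
open import Data.Sum using (inj₁; inj₂; [_,_]′)
open import Data.Product.Function.NonDependent.Propositional using (_×-⇔_)
open import Data.Sum.Function.Propositional using (_⊎-⇔_)
open import Function.Related.TypeIsomorphisms using (→-cong-⇔)
open import Function.Bundles using (_⇔_; mk⇔; Equivalence)
open import Function.Construct.Identity using (⇔-id)
open import Function.Construct.Composition using (_⇔-∘_)
open import Function.Construct.Symmetry using (⇔-sym)
open import Function.Related.Propositional using (module EquationalReasoning; equivalence)
open import Relation.Binary.PropositionalEquality
  using (_≡_; refl; sym; trans; cong; cong₂; subst; module ≡-Reasoning)

open Equivalence using (to; from)

-- Quantifiers respect pointwise equivalence after reindexing the bound
-- variable along a map f with a section s; used with f = id for
-- renamings and with f an automorphism for invariance.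
module _ {a p q : Level} {A : Set a} {P : A → Set p} {Q : A → Set q}
         (f s : A → A) (f∘s : ∀ b → f (s b) ≡ b)
         (P⇔Q : ∀ x → P x ⇔ Q (f x)) where

  Π-reindex : ((x : A) → P x) ⇔ ((y : A) → Q y)
  Π-reindex = mk⇔
    (λ g y → subst Q (f∘s y) (to (P⇔Q (s y)) (g (s y))))
    (λ g x → from (P⇔Q x) (g (f x)))

  Σ-reindex : Σ A P ⇔ Σ A Q
  Σ-reindex = mk⇔
    (λ (x , px) → f x , to (P⇔Q x) px)
    (λ (y , qy) → s y , from (P⇔Q (s y)) (subst Q (sym (f∘s y)) qy))

Σ-cong-⇔ : {a p q : Level} {A : Set a} {P : A → Set p} {Q : A → Set q} →
  (∀ x → P x ⇔ Q x) → Σ A P ⇔ Σ A Q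
Σ-cong-⇔ = Σ-reindex (λ x → x) (λ x → x) (λ _ → refl)

lift : ∀ {j k} → (Fin k → Fin j) → Fin (suc k) → Fin (suc j)
lift ρ zero = zero
lift ρ (suc i) = suc (ρ i)

-- Variable layout of w̄ ++ x̄ ++ z̄, seen from the blocks (w̄, z̄) and (x̄, w̄).
wz↪wxz : ∀ j n m → Fin (j + m) → Fin (j + (n + m))
wz↪wxz j n m i = [ (λ a → a ↑ˡ (n + m)) , (λ b → j ↑ʳ (n ↑ʳ b)) ]′ (splitAt j i)

xw↪wxz : ∀ j n m → Fin (n + j) → Fin (j + (n + m))
xw↪wxz j n m i = [ (λ a → j ↑ʳ (a ↑ˡ m)) , (λ b → b ↑ˡ (n + m)) ]′ (splitAt n i)

module Syntax {L : Signature} where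

  mutual
    renTerm : ∀ {j k} → (Fin k → Fin j) → Term L k → Term L j
    renTerm ρ (var i) = var (ρ i)
    renTerm ρ (app f ts) = app f (renTerms ρ ts)

    renTerms : ∀ {j k n} → (Fin k → Fin j) → Vec (Term L k) n → Vec (Term L j) n
    renTerms ρ [] = []
    renTerms ρ (t ∷ ts) = renTerm ρ t ∷ renTerms ρ ts

  ren : ∀ {j k} → (Fin k → Fin j) → Formula L k → Formula L j
  ren ρ falsum = falsum
  ren ρ (equal s t) = equal (renTerm ρ s) (renTerm ρ t)
  ren ρ (rel r ts) = rel r (renTerms ρ ts)
  ren ρ (and φ ψ) = and (ren ρ φ) (ren ρ ψ)
  ren ρ (or φ ψ) = or (ren ρ φ) (ren ρ ψ)
  ren ρ (imp φ ψ) = imp (ren ρ φ) (ren ρ ψ)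
  ren ρ (all φ) = all (ren (lift ρ) φ)
  ren ρ (ex φ) = ex (ren (lift ρ) φ)

  exists : ∀ j {k} → Formula L (j + k) → Formula L k
  exists zero φ = φ
  exists (suc j) φ = exists j (ex φ)

  compose : ∀ {j n m} → Formula L (j + m) → Formula L (n + j) → Formula L (n + m)
  compose {j} {n} {m} ψ₁ ψ₂ = exists j (and (ren (wz↪wxz j n m) ψ₁) (ren (xw↪wxz j n m) ψ₂))

open Syntax

module Semantics {L : Signature} (M : Structure L) where
  open Structure M

  _≈_∘_ : ∀ {j k} → Vec Carrier k → Vec Carrier j → (Fin k → Fin j) → Set
  e' ≈ e ∘ ρ = ∀ i → lookup e' i ≡ lookup e (ρ i)

  mutual
    evalTerm-ren : ∀ {j k} (ρ : Fin k → Fin j) {e : Vec Carrier j} {e' : Vec Carrier k} →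
      e' ≈ e ∘ ρ → (t : Term L k) → evalTerm M (renTerm ρ t) e ≡ evalTerm M t e'
    evalTerm-ren ρ eq (var i) = sym (eq i)
    evalTerm-ren ρ eq (app f ts) = cong (funI f) (evalTerms-ren ρ eq ts)

    evalTerms-ren : ∀ {j k n} (ρ : Fin k → Fin j) {e : Vec Carrier j} {e' : Vec Carrier k} →
      e' ≈ e ∘ ρ → (ts : Vec (Term L k) n) → evalTerms M (renTerms ρ ts) e ≡ evalTerms M ts e'
    evalTerms-ren ρ eq [] = refl
    evalTerms-ren ρ eq (t ∷ ts) = cong₂ _∷_ (evalTerm-ren ρ eq t) (evalTerms-ren ρ eq ts)

  lift-≈ : ∀ {j k} (ρ : Fin k → Fin j) {e : Vec Carrier j} {e' : Vec Carrier k} →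
    e' ≈ e ∘ ρ → ∀ a → (a ∷ e') ≈ (a ∷ e) ∘ lift ρ
  lift-≈ ρ eq a zero = refl
  lift-≈ ρ eq a (suc i) = eq i

  Sat-ren : ∀ {j k} (ρ : Fin k → Fin j) {e : Vec Carrier j} {e' : Vec Carrier k} →
    e' ≈ e ∘ ρ → (φ : Formula L k) → Sat M (ren ρ φ) e ⇔ Sat M φ e'
  Sat-ren ρ eq falsum = ⇔-id _
  Sat-ren ρ {e} {e'} eq (equal s t)
    rewrite evalTerm-ren ρ {e} {e'} eq s | evalTerm-ren ρ {e} {e'} eq t = ⇔-id _
  Sat-ren ρ {e} {e'} eq (rel r ts) rewrite evalTerms-ren ρ {e} {e'} eq ts = ⇔-id _
  Sat-ren ρ eq (and φ ψ) = Sat-ren ρ eq φ ×-⇔ Sat-ren ρ eq ψ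
  Sat-ren ρ eq (or φ ψ) = Sat-ren ρ eq φ ⊎-⇔ Sat-ren ρ eq ψ
  Sat-ren ρ eq (imp φ ψ) = →-cong-⇔ (Sat-ren ρ eq φ) (Sat-ren ρ eq ψ)
  Sat-ren ρ eq (all φ) =
    Π-reindex (λ a → a) (λ a → a) (λ _ → refl) (λ a → Sat-ren (lift ρ) (lift-≈ ρ eq a) φ)
  Sat-ren ρ eq (ex φ) = Σ-cong-⇔ (λ a → Sat-ren (lift ρ) (lift-≈ ρ eq a) φ)

  Sat-exists : ∀ j {k} (φ : Formula L (j + k)) (e : Vec Carrier k) →
    Sat M (exists j φ) e ⇔ Σ (Vec Carrier j) (λ w → Sat M φ (w ++ e))
  Sat-exists zero φ e = mk⇔ (λ p → [] , p) (λ { ([] , p) → p })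
  Sat-exists (suc j) φ e = mk⇔
    (λ p → let (w , a , q) = to (Sat-exists j (ex φ) e) p in a ∷ w , q)
    (λ { (a ∷ w , q) → from (Sat-exists j (ex φ) e) (w , a , q) })

  Sat-compose : ∀ {j n m} (ψ₁ : Formula L (j + m)) (ψ₂ : Formula L (n + j))
    (x : Vec Carrier n) (z : Vec Carrier m) →
    Sat M (compose {j = j} ψ₁ ψ₂) (x ++ z) ⇔
    Σ (Vec Carrier j) (λ w → Sat M ψ₁ (w ++ z) × Sat M ψ₂ (x ++ w))
  Sat-compose {j} {n} {m} ψ₁ ψ₂ x z =
    Σ-cong-⇔ (λ w → Sat-ren _ (wz-layout w) ψ₁ ×-⇔ Sat-ren _ (xw-layout w) ψ₂)
    ⇔-∘ Sat-exists j _ (x ++ z)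
    where
    wz-layout : ∀ (w : Vec Carrier j) → (w ++ z) ≈ (w ++ (x ++ z)) ∘ wz↪wxz j n m
    wz-layout w i rewrite lookup-splitAt j w z i with splitAt j i
    ... | inj₁ a = sym (lookup-++ˡ w (x ++ z) a)
    ... | inj₂ b = sym (trans (lookup-++ʳ w (x ++ z) (n ↑ʳ b)) (lookup-++ʳ x z b))

    xw-layout : ∀ (w : Vec Carrier j) → (x ++ w) ≈ (w ++ (x ++ z)) ∘ xw↪wxz j n m
    xw-layout w i rewrite lookup-splitAt n x w i with splitAt n i
    ... | inj₁ a = sym (trans (lookup-++ʳ w (x ++ z) (a ↑ˡ m)) (lookup-++ˡ x z a))
    ... | inj₂ b = sym (lookup-++ˡ w (x ++ z) b)

  module _ (g : Aut M) where

    mutual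
      evalTerm-aut : ∀ {k} (e : Vec Carrier k) (t : Term L k) →
        evalTerm M t (map (fun g) e) ≡ fun g (evalTerm M t e)
      evalTerm-aut e (var i) = lookup-map i (fun g) e
      evalTerm-aut e (app f ts) =
        trans (cong (funI f) (evalTerms-aut e ts)) (sym (pres-fun g f (evalTerms M ts e)))

      evalTerms-aut : ∀ {k n} (e : Vec Carrier k) (ts : Vec (Term L k) n) →
        evalTerms M ts (map (fun g) e) ≡ map (fun g) (evalTerms M ts e)
      evalTerms-aut e [] = refl
      evalTerms-aut e (t ∷ ts) = cong₂ _∷_ (evalTerm-aut e t) (evalTerms-aut e ts)

    -- g is injective, so it reflects equality.
    aut-≡ : ∀ x y → (x ≡ y) ⇔ (fun g x ≡ fun g y)
    aut-≡ x y = mk⇔ (cong (fun g))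
      (λ p → trans (sym (inv-l g x)) (trans (cong (inv g) p) (inv-l g y)))

    Sat-aut : ∀ {k} (φ : Formula L k) (e : Vec Carrier k) →
      Sat M φ e ⇔ Sat M φ (map (fun g) e)
    Sat-aut falsum e = ⇔-id _
    Sat-aut (equal s t) e
      rewrite evalTerm-aut e s | evalTerm-aut e t = aut-≡ _ _
    Sat-aut (rel r ts) e rewrite evalTerms-aut e ts = pres-rel g r _
    Sat-aut (and φ ψ) e = Sat-aut φ e ×-⇔ Sat-aut ψ e
    Sat-aut (or φ ψ) e = Sat-aut φ e ⊎-⇔ Sat-aut ψ e
    Sat-aut (imp φ ψ) e = →-cong-⇔ (Sat-aut φ e) (Sat-aut ψ e)
    Sat-aut (all φ) e = Π-reindex (fun g) (inv g) (inv-r g) (λ a → Sat-aut φ (a ∷ e))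
    Sat-aut (ex φ) e = Σ-reindex (fun g) (inv g) (inv-r g) (λ a → Sat-aut φ (a ∷ e))

module Automorphisms {L : Signature} (M : Structure L) where
  open Structure M
  open Semantics M

  _∘ᵃ_ : Aut M → Aut M → Aut M
  h₁ ∘ᵃ h₂ = record
    { fun = λ x → fun h₁ (fun h₂ x)
    ; inv = λ x → inv h₂ (inv h₁ x)
    ; inv-l = λ x → trans (cong (inv h₂) (inv-l h₁ (fun h₂ x))) (inv-l h₂ x)
    ; inv-r = λ x → trans (cong (fun h₁) (inv-r h₂ (inv h₁ x))) (inv-r h₁ x)
    ; pres-fun = λ f xs → trans (cong (fun h₁) (pres-fun h₂ f xs))
        (trans (pres-fun h₁ f (map (fun h₂) xs)) (cong (funI f) (sym (map-∘ (fun h₁) (fun h₂) xs))))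
    ; pres-rel = λ r xs →
        subst (λ ys → relI r xs ⇔ relI r ys) (sym (map-∘ (fun h₁) (fun h₂) xs))
          (pres-rel h₁ r (map (fun h₂) xs) ⇔-∘ pres-rel h₂ r xs)
    }

  map-inv-r : (g : Aut M) {n : ℕ} (x : Vec Carrier n) → map (fun g) (map (inv g) x) ≡ x
  map-inv-r g [] = refl
  map-inv-r g (a ∷ x) = cong₂ _∷_ (inv-r g a) (map-inv-r g x)

  image : ∀ {ℓ n} → Aut M → (Vec Carrier n → Set ℓ) → Vec Carrier n → Set ℓ
  image g D x = Σ (Vec Carrier _) (λ y → D y × map (fun g) y ≡ x)

  image-Sat : ∀ {n m} (g : Aut M) (φ : Formula L (n + m)) (v : Vec Carrier m)
    (x : Vec Carrier n) →
    image g (λ y → Sat M φ (y ++ v)) x ⇔ Sat M φ (x ++ map (fun g) v)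
  image-Sat g φ v x = mk⇔
    (λ (y , s , gy≡x) → subst (λ y' → Sat M φ (y' ++ map (fun g) v)) gy≡x (moved y s))
    (λ s → map (inv g) x , from (Sat-aut g φ _) (subst (Sat M φ) (sym g-env⁻¹) s) ,
           map-inv-r g x)
    where
    g-env : ∀ y → map (fun g) (y ++ v) ≡ map (fun g) y ++ map (fun g) v
    g-env y = map-++ (fun g) y v

    g-env⁻¹ : map (fun g) (map (inv g) x ++ v) ≡ x ++ map (fun g) v
    g-env⁻¹ = trans (g-env (map (inv g) x)) (cong (_++ map (fun g) v) (map-inv-r g x))

    moved : ∀ y → Sat M φ (y ++ v) → Sat M φ (map (fun g) y ++ map (fun g) v)
    moved y s = subst (Sat M φ) (g-env y) (to (Sat-aut g φ (y ++ v)) s)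

  orbit-∘ᴴ : ∀ {n} (H₁ H₂ : Aut M → Set) (v : Vec Carrier n) (x : Vec Carrier n) →
    orbit M (_∘ᴴ_ M H₁ H₂) v x ⇔ Σ (Aut M) (λ h₁ → H₁ h₁ × image h₁ (orbit M H₂ v) x)
  orbit-∘ᴴ H₁ H₂ v x = mk⇔
    (λ (h , (h₁ , h₂ , p₁ , p₂ , h≗h₁h₂) , hv≡x) →
       h₁ , p₁ , map (fun h₂) v , (h₂ , p₂ , refl) , factor h h₁ h₂ h≗h₁h₂ hv≡x)
    (λ (h₁ , p₁ , y , (h₂ , p₂ , h₂v≡y) , h₁y≡x) →
       h₁ ∘ᵃ h₂ , (h₁ , h₂ , p₁ , p₂ , (λ _ → refl)) ,
       trans (map-∘ (fun h₁) (fun h₂) v) (trans (cong (map (fun h₁)) h₂v≡y) h₁y≡x))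
    where
    factor : ∀ h h₁ h₂ → (∀ y → fun h y ≡ fun h₁ (fun h₂ y)) → map (fun h) v ≡ x →
      map (fun h₁) (map (fun h₂) v) ≡ x
    factor h h₁ h₂ h≗h₁h₂ hv≡x = begin
      map (fun h₁) (map (fun h₂) v)  ≡⟨ map-∘ (fun h₁) (fun h₂) v ⟨
      map (λ y → fun h₁ (fun h₂ y)) v ≡⟨ map-cong h≗h₁h₂ v ⟨
      map (fun h) v                  ≡⟨ hv≡x ⟩
      x                              ∎
      where open ≡-Reasoning

  Σ-orbit : ∀ {ℓ n} (H : Aut M → Set) (v : Vec Carrier n) (R : Vec Carrier n → Set ℓ) →
    Σ (Aut M) (λ h → H h × R (map (fun h) v)) ⇔ Σ (Vec Carrier n) (λ w → orbit M H v w × R w)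
  Σ-orbit H v R = mk⇔
    (λ (h , p , r) → map (fun h) v , (h , p , refl) , r)
    (λ (w , (h , p , hv≡w) , r) → h , p , subst R (sym hv≡w) r)

open Semantics
open Automorphisms

corollary5p2 : (L : Signature) (M : Structure L)
    (A : Structure.Carrier M → Set) {n : ℕ} (v : Vec (Structure.Carrier M) n)
    (H₁ H₂ : Aut M → Set) →
    SubsetAut M A H₁ → SubsetAut M A H₂ →
    DefinableOver M v (orbit M H₁ v) →
    DefinableOver M v (orbit M H₂ v) →
    DefinableOver M v (orbit M (_∘ᴴ_ M H₁ H₂) v)
corollary5p2 L M A {n} v H₁ H₂ _ _ (φ₁ , defines₁) (φ₂ , defines₂) =
  compose {j = n} φ₁ φ₂ , λ x → begin
    orbit M (_∘ᴴ_ M H₁ H₂) v x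
      ∼⟨ orbit-∘ᴴ M H₁ H₂ v x ⟩
    Σ (Aut M) (λ h₁ → H₁ h₁ × image M h₁ (orbit M H₂ v) x)
      ∼⟨ Σ-cong-⇔ (λ h₁ → ⇔-id _ ×-⇔ image-defines₂ h₁ x) ⟩
    Σ (Aut M) (λ h₁ → H₁ h₁ × Sat M φ₂ (x ++ map (fun h₁) v))
      ∼⟨ Σ-orbit M H₁ v (λ w → Sat M φ₂ (x ++ w)) ⟩
    Σ (Vec Carrier n) (λ w → orbit M H₁ v w × Sat M φ₂ (x ++ w))
      ∼⟨ Σ-cong-⇔ (λ w → defines₁ w ×-⇔ ⇔-id _) ⟩
    Σ (Vec Carrier n) (λ w → Sat M φ₁ (w ++ v) × Sat M φ₂ (x ++ w))
      ∼⟨ ⇔-sym (Sat-compose M {j = n} φ₁ φ₂ x v) ⟩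
    Sat M (compose {j = n} φ₁ φ₂) (x ++ v) ∎
  where
  open Structure M
  open EquationalReasoning {k = equivalence}

  image-defines₂ : ∀ h₁ x → image M h₁ (orbit M H₂ v) x ⇔ Sat M φ₂ (x ++ map (fun h₁) v)
  image-defines₂ h₁ x =
    image-Sat M h₁ φ₂ v x ⇔-∘ Σ-cong-⇔ (λ y → defines₂ y ×-⇔ ⇔-id _)
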